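{- Let $d,s,k$ be natural numbers and let $C(\vec x)$ be the condition that $x_i\ge 0$ for all $i\in\{0,\ldots,k\}$. Then the set $A_{d,s,k}\cup A_{d,10s,k,C}$ is 3-free.
   Context: For natural numbers $d,s,k$, $A_{d,s,k}$ is the set of integers $x$ that can be written as $x=\sum_{i=0}^{k-1} x_i (4d+1)^i$ with integers $-d\le x_i\le d$ and $\sum_{i=0}^{k-1}x_i^2=s$. For a condition $C$ on vectors $\vec x=(x_0,\ldots,x_k)$, $A_{d,s,k,C}$ is the set of integers $x$ that can be written as $x=\sum_{i=0}^{k} x_i (4d+1)^i$ with integers $-d\le x_i\le d$, $\sum_{i=0}^{k}x_i^2=s$, and $C(x_0,\ldots,x_k)$ true. A set of integers is 3-free if it contains no three elements $x<y<z$ with $x+z=2y$. -}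

module Defs where

open import Data.Nat using (ℕ; zero; suc)
open import Data.Integer using (ℤ; +_; -_; _+_; _*_; _≤_; _<_)
open import Data.Vec using (Vec; []; _∷_; foldr)
open import Data.Vec.Relation.Unary.All using (All)
open import Data.Product using (Σ; _×_; ∃)
open import Data.Sum using (_⊎_)
open import Relation.Binary.PropositionalEquality using (_≡_)
open import Relation.Nullary using (¬_)

baseVal : {n : ℕ} → ℤ → Vec ℤ n → ℤ
baseVal b []       = + 0
baseVal b (x ∷ xs) = x + b * baseVal b xs

sumSq : {n : ℕ} → Vec ℤ n → ℤ
sumSq []       = + 0
sumSq (x ∷ xs) = x * x + sumSq xs

InRange : ℕ → {n : ℕ} → Vec ℤ n → Set
InRange d xs = All (λ xi → (- (+ d)) ≤ xi × xi ≤ + d) xs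

base : ℕ → ℤ
base d = + 4 * + d + + 1

-- A_{d,s,k}: digits x₀ … x_{k-1}  (k digits)
A : ℕ → ℕ → ℕ → ℤ → Set
A d s k x = Σ (Vec ℤ k) λ xs →
  InRange d xs × sumSq xs ≡ + s × baseVal (base d) xs ≡ x

-- A_{d,s,k,C}: digits x₀ … x_k  (k+1 digits), satisfying condition C
AC : (d s k : ℕ) → (Vec ℤ (suc k) → Set) → ℤ → Set
AC d s k C x = Σ (Vec ℤ (suc k)) λ xs →
  InRange d xs × sumSq xs ≡ + s × C xs × baseVal (base d) xs ≡ x

Nonneg : {n : ℕ} → Vec ℤ n → Set
Nonneg xs = All (λ xi → + 0 ≤ xi) xs

ThreeFree : (ℤ → Set) → Set
ThreeFree S = ∀ x y z → S x → S y → S z → x < y → y < z → ¬ (x + z ≡ + 2 * y)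

{-# OPTIONS --safe #-}
-- Digits lie in [−d, d] and the base is 4d + 1, so x + z = 2y produces no carries: the digit
-- vectors u, v, w of x, y, z satisfy u + w = 2v coordinatewise. For such vectors the parallelogram
-- law reads |u − w|² = 2|u|² − 4|v|² + 2|w|², so equal norms force u = w, i.e. x = z. The norms
-- are s or 10s (the latter only for vectors with nonnegative digits), and in each mixed pattern
-- one of the nonnegative quantities |u − w|², |4u − 13v|², |4w − 13v|², 2 u·w equals −c·s with
-- c > 0, whence s = 0 and the norms agree after all.
module Submission where

open import Defs
open import Data.Sum using (_⊎_; inj₁; inj₂)

-- Integer multiplication is opened only inside this block, so that _*_ in the final statement is ℕ's.
module _ where
  open import Data.Nat as ℕ using (ℕ; zero; suc; z≤n)
  import Data.Nat.Properties as ℕ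
  open import Data.Integer using (ℤ; +_; -[1+_]; -_; _+_; _-_; _*_; ∣_∣; _≤_; +≤+; -≤-)
  open import Data.Integer.Properties
    using (+-0-abelianGroup; +-comm; +-identityˡ; +-mono-≤; *-identityˡ; *-zeroʳ; *-monoˡ-≤-nonNeg;
           pos-*; abs-*; ∣-i∣≡∣i∣; ∣i∣≡0⇒i≡0; ∣i+j∣≤∣i∣+∣j∣; ∣i-j∣≤∣i∣+∣j∣; i≡j⇒i-j≡0; i-j≡0⇒i≡j;
           i*j≡0⇒i≡0∨j≡0; neg-≤-pos)
  open import Algebra.Properties.AbelianGroup +-0-abelianGroup using (inverseˡ-unique; y≈x\\z)
  open import Data.Integer.Tactic.RingSolver using (solve-∀)
  open import Data.Vec using (Vec; []; _∷_; _∷ʳ_)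
  open import Data.Vec.Relation.Unary.All as All using (All; []; _∷_)
  open import Data.Product using (_×_; _,_; proj₁; proj₂)
  open import Data.Sum using (reduce)
  open import Data.Unit using (⊤)
  open import Relation.Binary.PropositionalEquality
    using (_≡_; refl; sym; trans; cong; cong₂; subst; subst₂; module ≡-Reasoning)

  private variable
    n m d s : ℕ
    a b r x y z : ℤ
    u v w : Vec ℤ n

  infixr 5 _∷_

  data Midpoint : Vec ℤ n → Vec ℤ n → Vec ℤ n → Set where
    []  : Midpoint [] [] []
    _∷_ : x + z ≡ + 2 * y → Midpoint u v w → Midpoint (x ∷ u) (y ∷ v) (z ∷ w)

  Midpoint-sym : Midpoint u v w → Midpoint w v u
  Midpoint-sym []                              = []
  Midpoint-sym {u = x ∷ _} {w = z ∷ _} (e ∷ m) = trans (+-comm z x) e ∷ Midpoint-sym m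

  small+multiple≡0 : ∣ a ∣ ℕ.< ∣ b ∣ → a + b * r ≡ + 0 → a ≡ + 0 × r ≡ + 0
  small+multiple≡0 {a} {b} {r} ∣a∣<∣b∣ a+br≡0 = a≡0 , r≡0
    where
    open ≡-Reasoning
    a≡-br : a ≡ - (b * r)
    a≡-br = inverseˡ-unique a (b * r) a+br≡0
    ∣a∣≡∣b∣∣r∣ : ∣ a ∣ ≡ ∣ b ∣ ℕ.* ∣ r ∣
    ∣a∣≡∣b∣∣r∣ = begin
      ∣ a ∣             ≡⟨ cong ∣_∣ a≡-br ⟩
      ∣ - (b * r) ∣     ≡⟨ ∣-i∣≡∣i∣ (b * r) ⟩
      ∣ b * r ∣         ≡⟨ abs-* b r ⟩
      ∣ b ∣ ℕ.* ∣ r ∣   ∎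
    r≡0 : r ≡ + 0
    r≡0 = ∣i∣≡0⇒i≡0 (ℕ.n<1⇒n≡0 (ℕ.*-cancelˡ-< ∣ b ∣ ∣ r ∣ 1
            (subst₂ ℕ._<_ ∣a∣≡∣b∣∣r∣ (sym (ℕ.*-identityʳ ∣ b ∣)) ∣a∣<∣b∣)))
    a≡0 : a ≡ + 0
    a≡0 = begin
      a             ≡⟨ a≡-br ⟩
      - (b * r)     ≡⟨ cong (λ t → - (b * t)) r≡0 ⟩
      - (b * + 0)   ≡⟨ cong -_ (*-zeroʳ b) ⟩
      + 0           ∎

  digit-bound : - (+ d) ≤ x × x ≤ + d → ∣ x ∣ ℕ.≤ d
  digit-bound {x = + _}      (_ , +≤+ x≤d) = x≤d
  digit-bound {zero}  { -[1+ _ ]} (() , _)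
  digit-bound {suc _} { -[1+ _ ]} (-≤- x≤d , _) = ℕ.s≤s x≤d

  defect : ℤ → ℤ → ℤ → ℤ
  defect x y z = x + z - + 2 * y

  defect-bound : ∣ x ∣ ℕ.≤ d → ∣ y ∣ ℕ.≤ d → ∣ z ∣ ℕ.≤ d → ∣ defect x y z ∣ ℕ.≤ 4 ℕ.* d
  defect-bound {x} {d} {y} {z} ∣x∣≤d ∣y∣≤d ∣z∣≤d = begin
    ∣ x + z - + 2 * y ∣               ≤⟨ ∣i-j∣≤∣i∣+∣j∣ (x + z) (+ 2 * y) ⟩
    ∣ x + z ∣ ℕ.+ ∣ + 2 * y ∣         ≤⟨ ℕ.+-mono-≤ (∣i+j∣≤∣i∣+∣j∣ x z) (ℕ.≤-reflexive (abs-* (+ 2) y)) ⟩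
    ∣ x ∣ ℕ.+ ∣ z ∣ ℕ.+ 2 ℕ.* ∣ y ∣   ≤⟨ ℕ.+-mono-≤ (ℕ.+-mono-≤ ∣x∣≤d ∣z∣≤d) (ℕ.*-monoʳ-≤ 2 ∣y∣≤d) ⟩
    d ℕ.+ d ℕ.+ 2 ℕ.* d               ≡⟨ ℕ.+-assoc d d (2 ℕ.* d) ⟩
    4 ℕ.* d                           ∎
    where open ℕ.≤-Reasoning

  defect-∷ : ∀ b x y z X Y Z →
             defect (x + b * X) (y + b * Y) (z + b * Z) ≡ defect x y z + b * defect X Y Z
  defect-∷ = identity
    where
    identity : ∀ b x y z X Y Z →
      (x + b * X) + (z + b * Z) - + 2 * (y + b * Y) ≡ (x + z - + 2 * y) + b * (X + Z - + 2 * Y)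
    identity = solve-∀

  carry-free-midpoint : 4 ℕ.* d ℕ.< ∣ b ∣ → InRange d u → InRange d v → InRange d w →
                        baseVal b u + baseVal b w ≡ + 2 * baseVal b v → Midpoint u v w
  carry-free-midpoint _ [] [] [] _ = []
  carry-free-midpoint {d = d} {b = b} {u = x ∷ u} {v = y ∷ v} {w = z ∷ w}
                      4d<∣b∣ (x∈ ∷ u∈) (y∈ ∷ v∈) (z∈ ∷ w∈) e =
    i-j≡0⇒i≡j _ _ (proj₁ no-carry) ∷ carry-free-midpoint 4d<∣b∣ u∈ v∈ w∈ (i-j≡0⇒i≡j _ _ (proj₂ no-carry))
    where
    ∣defect∣≤4d : ∣ defect x y z ∣ ℕ.≤ 4 ℕ.* d
    ∣defect∣≤4d = defect-bound {x = x} {y = y} {z = z} (digit-bound x∈) (digit-bound y∈) (digit-bound z∈)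
    no-carry : defect x y z ≡ + 0 × defect (baseVal b u) (baseVal b v) (baseVal b w) ≡ + 0
    no-carry = small+multiple≡0 {b = b} (ℕ.≤-<-trans ∣defect∣≤4d 4d<∣b∣)
                                        (trans (sym (defect-∷ b x y z _ _ _)) (i≡j⇒i-j≡0 e))

  weighted-squares : ℤ → ℤ → ℤ → ℤ → ℤ → ℤ → ℤ
  weighted-squares a b c x y z = a * (x * x) + b * (y * y) + c * (z * z)

  weighted-norms : ℤ → ℤ → ℤ → Vec ℤ n → Vec ℤ n → Vec ℤ n → ℤ
  weighted-norms a b c u v w = a * sumSq u + b * sumSq v + c * sumSq w

  weighted-norms-[] : ∀ a b c → weighted-norms a b c [] [] [] ≡ + 0
  weighted-norms-[] = identity
    where
    identity : ∀ a b c → a * + 0 + b * + 0 + c * + 0 ≡ + 0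
    identity = solve-∀

  weighted-norms-∷ : ∀ a b c x y z (u v w : Vec ℤ n) →
                     weighted-norms a b c (x ∷ u) (y ∷ v) (z ∷ w) ≡
                     weighted-squares a b c x y z + weighted-norms a b c u v w
  weighted-norms-∷ a b c x y z u v w = identity a b c x y z (sumSq u) (sumSq v) (sumSq w)
    where
    identity : ∀ a b c x y z p q r →
      a * (x * x + p) + b * (y * y + q) + c * (z * z + r) ≡
      (a * (x * x) + b * (y * y) + c * (z * z)) + (a * p + b * q + c * r)
    identity = solve-∀

  weighted-sum-cong : ∀ a b c {p p′ q q′ r r′} → p ≡ p′ → q ≡ q′ → r ≡ r′ →
                      a * p + b * q + c * r ≡ a * p′ + b * q′ + c * r′
  weighted-sum-cong a b c p≡p′ q≡q′ r≡r′ =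
    cong₂ _+_ (cong₂ _+_ (cong (a *_) p≡p′) (cong (b *_) q≡q′)) (cong (c *_) r≡r′)

  weighted-norms-nonneg : ∀ {P : ℤ → Set} a b c →
    (∀ x y z → x + z ≡ + 2 * y → P x → P z → + 0 ≤ weighted-squares a b c x y z) →
    Midpoint u v w → All P u → All P w → + 0 ≤ weighted-norms a b c u v w
  weighted-norms-nonneg a b c _ [] [] [] = subst (+ 0 ≤_) (sym (weighted-norms-[] a b c)) (+≤+ z≤n)
  weighted-norms-nonneg {u = x ∷ u} {v = y ∷ v} {w = z ∷ w}
                        a b c digitwise (e ∷ m) (px ∷ pu) (pz ∷ pw) =
    subst (+ 0 ≤_) (sym (weighted-norms-∷ a b c x y z u v w))
      (+-mono-≤ (digitwise x y z e px pz) (weighted-norms-nonneg a b c digitwise m pu pw))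

  midpoint-identity : (f g : ℤ → ℤ → ℤ → ℤ) →
                      (∀ x y → f x y (- x + + 2 * y) ≡ g x y (- x + + 2 * y)) →
                      ∀ x y z → x + z ≡ + 2 * y → f x y z ≡ g x y z
  midpoint-identity f g identity x y z e =
    subst (λ t → f x y t ≡ g x y t) (sym (y≈x\\z x z (+ 2 * y) e)) (identity x y)

  square-nonneg : ∀ x → + 0 ≤ x * x
  square-nonneg (+ n)    = subst (+ 0 ≤_) (pos-* n n) (+≤+ z≤n)
  square-nonneg -[1+ _ ] = +≤+ z≤n

  product-nonneg : + 0 ≤ x → + 0 ≤ z → + 0 ≤ x * z
  product-nonneg {+ m} {+ n} _ _ = subst (+ 0 ≤_) (pos-* m n) (+≤+ z≤n)

  parallelogram-law : ∀ x y z → x + z ≡ + 2 * y →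
                      (x - z) * (x - z) ≡ weighted-squares (+ 2) (- + 4) (+ 2) x y z
  parallelogram-law =
    midpoint-identity (λ x _ z → (x - z) * (x - z)) (weighted-squares (+ 2) (- + 4) (+ 2)) identity
    where
    identity : ∀ x y → (x - (- x + + 2 * y)) * (x - (- x + + 2 * y)) ≡
      + 2 * (x * x) + - + 4 * (y * y) + + 2 * ((- x + + 2 * y) * (- x + + 2 * y))
    identity = solve-∀

  -- 4 and 13 make the weights negative on the norm pattern (10, 1, 1): −100 + 65 + 26 = −9.
  skew-law : ∀ x y z → x + z ≡ + 2 * y →
             (+ 4 * x - + 13 * y) * (+ 4 * x - + 13 * y) ≡
             weighted-squares (- + 10) (+ 65) (+ 26) x y z
  skew-law =
    midpoint-identity (λ x y _ → (+ 4 * x - + 13 * y) * (+ 4 * x - + 13 * y))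
                      (weighted-squares (- + 10) (+ 65) (+ 26)) identity
    where
    identity : ∀ x y → (+ 4 * x - + 13 * y) * (+ 4 * x - + 13 * y) ≡
      - + 10 * (x * x) + + 65 * (y * y) + + 26 * ((- x + + 2 * y) * (- x + + 2 * y))
    identity = solve-∀

  product-law : ∀ x y z → x + z ≡ + 2 * y →
                + 2 * (x * z) ≡ weighted-squares (- + 1) (+ 4) (- + 1) x y z
  product-law =
    midpoint-identity (λ x _ z → + 2 * (x * z)) (weighted-squares (- + 1) (+ 4) (- + 1)) identity
    where
    identity : ∀ x y → + 2 * (x * (- x + + 2 * y)) ≡
      - + 1 * (x * x) + + 4 * (y * y) + - + 1 * ((- x + + 2 * y) * (- x + + 2 * y))
    identity = solve-∀

  parallelogram-inequality : Midpoint u v w → + 0 ≤ weighted-norms (+ 2) (- + 4) (+ 2) u v w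
  parallelogram-inequality m =
    weighted-norms-nonneg (+ 2) (- + 4) (+ 2) digitwise m (All.universal _ _) (All.universal _ _)
    where
    digitwise : ∀ x y z → x + z ≡ + 2 * y → ⊤ → ⊤ →
                + 0 ≤ weighted-squares (+ 2) (- + 4) (+ 2) x y z
    digitwise x y z e _ _ = subst (+ 0 ≤_) (parallelogram-law x y z e) (square-nonneg (x - z))

  skew-inequality : Midpoint u v w → + 0 ≤ weighted-norms (- + 10) (+ 65) (+ 26) u v w
  skew-inequality m =
    weighted-norms-nonneg (- + 10) (+ 65) (+ 26) digitwise m (All.universal _ _) (All.universal _ _)
    where
    digitwise : ∀ x y z → x + z ≡ + 2 * y → ⊤ → ⊤ →
                + 0 ≤ weighted-squares (- + 10) (+ 65) (+ 26) x y z
    digitwise x y z e _ _ = subst (+ 0 ≤_) (skew-law x y z e) (square-nonneg (+ 4 * x - + 13 * y))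

  product-inequality : Midpoint u v w → Nonneg u → Nonneg w →
                       + 0 ≤ weighted-norms (- + 1) (+ 4) (- + 1) u v w
  product-inequality = weighted-norms-nonneg (- + 1) (+ 4) (- + 1) digitwise
    where
    digitwise : ∀ x y z → x + z ≡ + 2 * y → + 0 ≤ x → + 0 ≤ z →
                + 0 ≤ weighted-squares (- + 1) (+ 4) (- + 1) x y z
    digitwise x y z e 0≤x 0≤z =
      subst (+ 0 ≤_) (product-law x y z e) (*-monoˡ-≤-nonNeg (+ 2) (product-nonneg 0≤x 0≤z))

  nonneg-sum≡0 : + 0 ≤ a → + 0 ≤ b → a + b ≡ + 0 → a ≡ + 0 × b ≡ + 0
  nonneg-sum≡0 {+ zero} {+ zero} _ _ _ = refl , refl

  square≡0 : ∀ x → x * x ≡ + 0 → x ≡ + 0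
  square≡0 x x²≡0 = reduce (i*j≡0⇒i≡0∨j≡0 x x²≡0)

  midpoint-rigid : Midpoint u v w → weighted-norms (+ 2) (- + 4) (+ 2) u v w ≡ + 0 → u ≡ w
  midpoint-rigid [] _ = refl
  midpoint-rigid {u = x ∷ u} {v = y ∷ v} {w = z ∷ w} (e ∷ m) total≡0 =
    cong₂ _∷_ x≡z (midpoint-rigid m (proj₂ parts≡0))
    where
    split : (x - z) * (x - z) + weighted-norms (+ 2) (- + 4) (+ 2) u v w ≡ + 0
    split = trans (cong (_+ _) (parallelogram-law x y z e))
                  (trans (sym (weighted-norms-∷ (+ 2) (- + 4) (+ 2) x y z u v w)) total≡0)
    parts≡0 : (x - z) * (x - z) ≡ + 0 × weighted-norms (+ 2) (- + 4) (+ 2) u v w ≡ + 0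
    parts≡0 = nonneg-sum≡0 (square-nonneg (x - z)) (parallelogram-inequality m) split
    x≡z : x ≡ z
    x≡z = i-j≡0⇒i≡j x z (square≡0 (x - z) (proj₁ parts≡0))

  data Shape (s : ℕ) (u : Vec ℤ n) : Set where
    plain  : sumSq u ≡ + s → Shape s u
    scaled : sumSq u ≡ + (10 ℕ.* s) → Nonneg u → Shape s u

  weight : Shape s u → ℤ
  weight (plain _)    = + 1
  weight (scaled _ _) = + 10

  sumSq-shape : (σ : Shape s u) → sumSq u ≡ weight σ * + s
  sumSq-shape {s} (plain p)    = trans p (sym (*-identityˡ (+ s)))
  sumSq-shape {s} (scaled p _) = trans p (pos-* 10 s)

  data EqualNorms (u v w : Vec ℤ n) : Set where
    equal-norms : ∀ {S} → sumSq u ≡ S → sumSq v ≡ S → sumSq w ≡ S → EqualNorms u v w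

  EqualNorms-sym : EqualNorms u v w → EqualNorms w v u
  EqualNorms-sym (equal-norms p q r) = equal-norms r q p

  equal-norms-rigid : Midpoint u v w → EqualNorms u v w → u ≡ w
  equal-norms-rigid m (equal-norms {S} p q r) =
    midpoint-rigid m (trans (weighted-sum-cong (+ 2) (- + 4) (+ 2) p q r) (cancel S))
    where
    cancel : ∀ S → + 2 * S + - + 4 * S + + 2 * S ≡ + 0
    cancel = solve-∀

  nonneg-negative-multiple : + 0 ≤ -[1+ m ] * + s → s ≡ 0
  nonneg-negative-multiple {s = zero} _ = refl

  negative-weights-equal-norms : ∀ a b c (σu : Shape s u) (σv : Shape s v) (σw : Shape s w) →
    + 0 ≤ weighted-norms a b c u v w → a * weight σu + b * weight σv + c * weight σw ≡ -[1+ m ] →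
    EqualNorms u v w
  negative-weights-equal-norms {s} {u = u} {v} {w} {m} a b c σu σv σw 0≤form coefficient =
    equal-norms (vanishes σu) (vanishes σv) (vanishes σw)
    where
    open ≡-Reasoning
    factor : ∀ a b c p q r t → a * (p * t) + b * (q * t) + c * (r * t) ≡ (a * p + b * q + c * r) * t
    factor = solve-∀
    form≡ : weighted-norms a b c u v w ≡ -[1+ m ] * + s
    form≡ = begin
      weighted-norms a b c u v w
        ≡⟨ weighted-sum-cong a b c (sumSq-shape σu) (sumSq-shape σv) (sumSq-shape σw) ⟩
      a * (weight σu * + s) + b * (weight σv * + s) + c * (weight σw * + s)
        ≡⟨ factor a b c (weight σu) (weight σv) (weight σw) (+ s) ⟩
      (a * weight σu + b * weight σv + c * weight σw) * + s
        ≡⟨ cong (_* + s) coefficient ⟩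
      -[1+ m ] * + s ∎
    s≡0 : s ≡ 0
    s≡0 = nonneg-negative-multiple {m = m} (subst (+ 0 ≤_) form≡ 0≤form)
    vanishes : ∀ {n} {t : Vec ℤ n} (σ : Shape s t) → sumSq t ≡ + 0
    vanishes {t = t} σ = begin
      sumSq t          ≡⟨ sumSq-shape σ ⟩
      weight σ * + s   ≡⟨ cong (λ t → weight σ * + t) s≡0 ⟩
      weight σ * + 0   ≡⟨ *-zeroʳ (weight σ) ⟩
      + 0              ∎

  shapes-equal-norms : Midpoint u v w → Shape s u → Shape s v → Shape s w → EqualNorms u v w
  shapes-equal-norms m (plain p)    (plain q)    (plain r)    = equal-norms p q r
  shapes-equal-norms m (scaled p _) (scaled q _) (scaled r _) = equal-norms p q r
  shapes-equal-norms m σu@(plain _) σv@(scaled _ _) σw@(plain _) =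
    negative-weights-equal-norms (+ 2) (- + 4) (+ 2) σu σv σw (parallelogram-inequality m) refl
  shapes-equal-norms m σu@(plain _) σv@(scaled _ _) σw@(scaled _ _) =
    negative-weights-equal-norms (+ 2) (- + 4) (+ 2) σu σv σw (parallelogram-inequality m) refl
  shapes-equal-norms m σu@(scaled _ _) σv@(scaled _ _) σw@(plain _) =
    negative-weights-equal-norms (+ 2) (- + 4) (+ 2) σu σv σw (parallelogram-inequality m) refl
  shapes-equal-norms m σu@(scaled _ _) σv@(plain _) σw@(plain _) =
    negative-weights-equal-norms (- + 10) (+ 65) (+ 26) σu σv σw (skew-inequality m) refl
  shapes-equal-norms m σu@(plain _) σv@(plain _) σw@(scaled _ _) =
    EqualNorms-sym
      (negative-weights-equal-norms (- + 10) (+ 65) (+ 26) σw σv σu (skew-inequality (Midpoint-sym m)) refl)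
  shapes-equal-norms m σu@(scaled _ u≥0) σv@(plain _) σw@(scaled _ w≥0) =
    negative-weights-equal-norms (- + 1) (+ 4) (- + 1) σu σv σw (product-inequality m u≥0 w≥0) refl

  baseVal-∷ʳ0 : ∀ b (u : Vec ℤ n) → baseVal b (u ∷ʳ + 0) ≡ baseVal b u
  baseVal-∷ʳ0 b []      = trans (+-identityˡ (b * + 0)) (*-zeroʳ b)
  baseVal-∷ʳ0 b (x ∷ u) = cong (λ t → x + b * t) (baseVal-∷ʳ0 b u)

  sumSq-∷ʳ0 : ∀ (u : Vec ℤ n) → sumSq (u ∷ʳ + 0) ≡ sumSq u
  sumSq-∷ʳ0 []      = refl
  sumSq-∷ʳ0 (x ∷ u) = cong (_+_ (x * x)) (sumSq-∷ʳ0 u)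

  InRange-∷ʳ0 : InRange d u → InRange d (u ∷ʳ + 0)
  InRange-∷ʳ0 []         = (neg-≤-pos , +≤+ z≤n) ∷ []
  InRange-∷ʳ0 (x∈ ∷ u∈) = x∈ ∷ InRange-∷ʳ0 u∈

  ∣base∣ : ∣ base d ∣ ≡ suc (4 ℕ.* d)
  ∣base∣ {d} = trans (cong (λ t → ∣ t + + 1 ∣) (sym (pos-* 4 d))) (ℕ.+-comm (4 ℕ.* d) 1)

  record Representation (d s n : ℕ) (x : ℤ) : Set where
    constructor representation
    field
      digits   : Vec ℤ n
      in-range : InRange d digits
      shape    : Shape s digits
      value    : baseVal (base d) digits ≡ x

  -- Elements of A d s k have only k digits; a leading digit 0 brings them to the k + 1 of the other set.
  represent : ∀ {k x} → A d s k x ⊎ AC d (10 ℕ.* s) k Nonneg x → Representation d s (suc k) x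
  represent {d} (inj₁ (u , u∈ , ∣u∣² , u↦x)) =
    representation (u ∷ʳ + 0) (InRange-∷ʳ0 u∈) (plain (trans (sumSq-∷ʳ0 u) ∣u∣²))
                   (trans (baseVal-∷ʳ0 (base d) u) u↦x)
  represent (inj₂ (u , u∈ , ∣u∣² , u≥0 , u↦x)) = representation u u∈ (scaled ∣u∣² u≥0) u↦x

  midpoint-of-representations : Representation d s n x → Representation d s n y →
                                Representation d s n z → x + z ≡ + 2 * y → x ≡ z
  midpoint-of-representations {d}
    (representation u u∈ σu refl) (representation v v∈ σv refl) (representation w w∈ σw refl) x+z≡2y =
    cong (baseVal (base d)) (equal-norms-rigid midpoint (shapes-equal-norms midpoint σu σv σw))
    where
    midpoint : Midpoint u v w
    midpoint = carry-free-midpoint (ℕ.≤-reflexive (sym (∣base∣ {d}))) u∈ v∈ w∈ x+z≡2y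

open import Data.Nat using (ℕ; _*_)
open import Data.Integer.Properties using (<-irrefl; <-trans)
open import Relation.Binary.PropositionalEquality using (_≡_)

mainTheorem7 : (d s k : ℕ) → ThreeFree (λ x → A d s k x ⊎ AC d (10 * s) k Nonneg x)
mainTheorem7 d s k x y z x∈ y∈ z∈ x<y y<z x+z≡2y = <-irrefl x≡z (<-trans x<y y<z)
  where
  x≡z : x ≡ z
  x≡z = midpoint-of-representations (represent x∈) (represent y∈) (represent z∈) x+z≡2y
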